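{- Let $n$ and $p$ be integers with $n\equiv 0\pmod 3$ and $p\not\equiv 1\pmod 3$. Then there does not exist an integer $\alpha<n$ such that $\gcd(n,\alpha)=1$, $\gcd(n,\alpha-2p-1)=1$ and $\gcd(n,n-(\alpha+2p+1))=1$. -}

module Defs where

module Submission where

-- Since 3 ∣ n, any x with gcd n x ≡ 1 is prime to 3.  The three
-- numbers in the theorem are, modulo 3,
--     α ,   α - 2p - 1 ≡ α + d ,   n - (α + 2p + 1) ≡ -(α - d) ,
-- where d = p - 1 is prime to 3 by hypothesis.  But an arithmetic progression
-- a - d, a, a + d of length three whose step d is prime to 3 runs through all
-- residues modulo 3, so one of its terms is divisible by 3: contradiction.
--
-- Arithmetic is done with signed divisibility, which is closed under sums
-- and differences; the statement's unsigned divisibility is converted at the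
-- boundary.

open import Defs
open import Data.Integer using (ℤ; +_; -_; _+_; _-_; _*_; _<_; ∣_∣)
open import Data.Integer.GCD using (gcd; gcd-greatest)
open import Data.Integer.Divisibility using (_∣_)
open import Data.Product using (∃; _×_; _,_)
open import Data.Sum using (_⊎_; inj₁; inj₂)
open import Relation.Nullary using (¬_; contradiction)
open import Relation.Binary.PropositionalEquality using (_≡_; refl; sym; subst)
open import Data.Nat as ℕ using (s≤s)
import Data.Nat.Divisibility as ℕ
import Data.Integer.Divisibility.Signed as Signed
open Signed using (divides; ∣ᵤ⇒∣; ∣⇒∣ᵤ; ∣m∣n⇒∣m+n; ∣m∣n⇒∣m-n)
open import Data.Integer.DivMod using (_%_; _/_; a≡a%n+[a/n]*n; n%d<d)
open import Data.Integer.Tactic.RingSolver using (solve-∀)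

3∣_ : ℤ → Set
3∣ x = + 3 Signed.∣ x

3∣-resp : ∀ {x y} → x ≡ y → 3∣ y → 3∣ x
3∣-resp x≡y = subst 3∣_ (sym x≡y)

3∣-multiple : ∀ k → 3∣ (k * + 3)
3∣-multiple k = divides k refl

common-divisor-of-coprime : ∀ {d n x} → d ∣ n → d ∣ x → gcd n x ≡ + 1 → ∣ d ∣ ≡ 1
common-divisor-of-coprime {d} {n} {x} d∣n d∣x gcd≡1 =
  ℕ.∣1⇒≡1 (subst (d ∣_) gcd≡1 (gcd-greatest {n} {x} {d} d∣n d∣x))

coprime-to-multiple-of-3 : ∀ {n x} → + 3 ∣ n → gcd n x ≡ + 1 → ¬ 3∣ x
coprime-to-multiple-of-3 {n} {x} 3∣n gcd≡1 3∣x
  with common-divisor-of-coprime {+ 3} {n} {x} 3∣n (∣⇒∣ᵤ 3∣x) gcd≡1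
... | ()

residue-mod-3 : ∀ x → 3∣ x ⊎ 3∣ (x - + 1) ⊎ 3∣ (x + + 1)
residue-mod-3 x = by-remainder (x % + 3) (x / + 3) (n%d<d x (+ 3)) (a≡a%n+[a/n]*n x (+ 3))
  where
  by-remainder : ∀ r q → r ℕ.< 3 → x ≡ + r + q * + 3 → 3∣ x ⊎ 3∣ (x - + 1) ⊎ 3∣ (x + + 1)
  by-remainder 0 q _ refl = inj₁ (divides q (rem0 q))
    where rem0 : ∀ q → + 0 + q * + 3 ≡ q * + 3
          rem0 = solve-∀
  by-remainder 1 q _ refl = inj₂ (inj₁ (divides q (rem1 q)))
    where rem1 : ∀ q → (+ 1 + q * + 3) - + 1 ≡ q * + 3
          rem1 = solve-∀
  by-remainder 2 q _ refl = inj₂ (inj₂ (divides (q + + 1) (rem2 q)))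
    where rem2 : ∀ q → (+ 2 + q * + 3) + + 1 ≡ (q + + 1) * + 3
          rem2 = solve-∀
  by-remainder (ℕ.suc (ℕ.suc (ℕ.suc _))) _ (s≤s (s≤s (s≤s ()))) _

-- Shifting both terms of a difference by c (or the terms of a sum by c and
-- -c) does not change it; this combines witnesses for a ∓ 1 and d ∓ 1.
shift-difference : ∀ a d c → a - d ≡ (a + c) - (d + c)
shift-difference = solve-∀

shift-sum : ∀ a d c → a + d ≡ (a + c) + (d - c)
shift-sum = solve-∀

-- A three-term arithmetic progression a - d, a, a + d whose step d is prime
-- to 3 contains a multiple of 3: if a ≢ 0 then a ≡ ±1 and d ≡ ±1, and the
-- difference (equal signs) or sum (opposite signs) of the two witnesses of
-- divisibility shows 3 ∣ a - d or 3 ∣ a + d.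
progression-hits-multiple-of-3 : ∀ a d → ¬ 3∣ d → 3∣ (a - d) ⊎ 3∣ a ⊎ 3∣ (a + d)
progression-hits-multiple-of-3 a d 3∤d with residue-mod-3 a | residue-mod-3 d
... | inj₁ 3∣a          | _                 = inj₂ (inj₁ 3∣a)
... | inj₂ _            | inj₁ 3∣d          = contradiction 3∣d 3∤d
... | inj₂ (inj₁ 3∣a-1) | inj₂ (inj₁ 3∣d-1) =
  inj₁ (3∣-resp (shift-difference a d (- + 1)) (∣m∣n⇒∣m-n 3∣a-1 3∣d-1))
... | inj₂ (inj₂ 3∣a+1) | inj₂ (inj₂ 3∣d+1) =
  inj₁ (3∣-resp (shift-difference a d (+ 1)) (∣m∣n⇒∣m-n 3∣a+1 3∣d+1))
... | inj₂ (inj₁ 3∣a-1) | inj₂ (inj₂ 3∣d+1) =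
  inj₂ (inj₂ (3∣-resp (shift-sum a d (- + 1)) (∣m∣n⇒∣m+n 3∣a-1 3∣d+1)))
... | inj₂ (inj₂ 3∣a+1) | inj₂ (inj₁ 3∣d-1) =
  inj₂ (inj₂ (3∣-resp (shift-sum a d (+ 1)) (∣m∣n⇒∣m+n 3∣a+1 3∣d-1)))

-- The three numbers of the theorem, rewritten as the progression with
-- a = α and d = p - 1, up to multiples of 3.
second-as-progression : ∀ α p → α - + 2 * p - + 1 ≡ (α + (p - + 1)) - p * + 3
second-as-progression = solve-∀

third-as-progression : ∀ n α p → n - (α + + 2 * p + + 1) ≡ (n - p * + 3) - (α - (p - + 1))
third-as-progression = solve-∀

mainTheorem7 : (n p : ℤ) → (+ 3) ∣ n → ¬ ((+ 3) ∣ (p - + 1))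
    → ¬ (∃ λ (α : ℤ) → α < n
          × gcd n α ≡ + 1
          × gcd n (α - + 2 * p - + 1) ≡ + 1
          × gcd n (n - (α + + 2 * p + + 1)) ≡ + 1)
mainTheorem7 n p 3∣n 3∤p-1 (α , _ , gcd₁ , gcd₂ , gcd₃)
  with progression-hits-multiple-of-3 α (p - + 1) (λ 3∣p-1 → 3∤p-1 (∣⇒∣ᵤ 3∣p-1))
... | inj₂ (inj₁ 3∣α) = coprime-to-multiple-of-3 {n} {α} 3∣n gcd₁ 3∣α
... | inj₂ (inj₂ 3∣α+d) =
  coprime-to-multiple-of-3 {n} 3∣n gcd₂
    (3∣-resp (second-as-progression α p) (∣m∣n⇒∣m-n 3∣α+d (3∣-multiple p)))
... | inj₁ 3∣α-d =
  coprime-to-multiple-of-3 {n} 3∣n gcd₃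
    (3∣-resp (third-as-progression n α p)
      (∣m∣n⇒∣m-n (∣m∣n⇒∣m-n (∣ᵤ⇒∣ {+ 3} {n} 3∣n) (3∣-multiple p)) 3∣α-d))
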